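{- Let $G$ be a graph with a convex drawing whose outer cycle admits a triangulation with edge piercing number at most $c$. Then $G$ has a balanced separator of size at most $c+2$.
   Context: A convex drawing of a finite simple graph $G$ places the vertices at distinct points of a circle and draws every edge as a straight-line segment; let $v_1,\dots,v_n$ be the counterclockwise cyclic vertex order. Two pairs of four distinct vertices are intertwined if their vertices alternate in the cyclic order. The outer cycle is the cycle $v_1v_2\cdots v_nv_1$ (regardless of whether these pairs are edges of $G$). A triangulation of the outer cycle is a set of vertex pairs, called links, consisting of the $n$ outer links $\{v_t,v_{t+1}\}$ (indices mod $n$) together with $n-3$ pairwise non-intertwined pairs of non-consecutive vertices (inner links), so that the links form a triangulated $n$-gon. A link is pierced by an edge of $G$ if the link and the edge are intertwined; the piercing number of a link is the number of edges of $G$ piercing it; the edge piercing number of the triangulation is the maximum piercing number over its links. A pair $(A,B)$ of vertex sets of $G$ is a separation if $A\cup B=V(G)$ and there is no edge between $A\setminus B$ and $B\setminus A$; it is balanced if $|A\setminus B|\le 2n/3$ and $|B\setminus A|\le 2n/3$. A balanced separator is a set $A\cap B$ for a balanced separation $(A,B)$, and its size is $|A\cap B|$. -}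

module Defs where

open import Data.Bool using (Bool; true; false)
open import Data.Nat as ℕ using (ℕ; zero; suc; _≤_; _*_; _+_; _∸_)
open import Data.Fin as Fin using (Fin; toℕ)
open import Data.Fin.Properties as FinP using ()
open import Data.Fin.Subset using (Subset; _∈_; _∉_; _∩_; _∪_; _─_; ∣_∣; ⊤)
open import Data.Product using (_×_; _,_; proj₁; proj₂)
open import Data.Sum using (_⊎_)
open import Data.List using (List; length; filter; cartesianProduct; allFin)
open import Data.List.Membership.Propositional using () renaming (_∈_ to _∈ˡ_)
open import Data.List.Relation.Unary.All using (All)
open import Data.List.Relation.Unary.AllPairs using (AllPairs)
open import Relation.Binary.PropositionalEquality using (_≡_; _≢_)
open import Relation.Nullary using (¬_; Dec)
open import Relation.Nullary.Decidable using (_×-dec_; _⊎-dec_; ¬?)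

-- A finite simple graph on the vertex set Fin n.  The convex drawing is
-- encoded by identifying the counterclockwise cyclic order v_1,…,v_n with
-- the order 0,1,…,n-1 of Fin n.
record Graph (n : ℕ) : Set where
  field
    adj     : Fin n → Fin n → Bool
    sym     : ∀ x y → adj x y ≡ adj y x
    irrefl  : ∀ x → adj x x ≡ false
open Graph public

Between : ∀ {n} → Fin n → Fin n → Fin n → Set
Between a b x = (a Fin.< x × x Fin.< b) ⊎ (b Fin.< x × x Fin.< a)

between? : ∀ {n} (a b x : Fin n) → Dec (Between a b x)
between? a b x = ((a Fin.<? x) ×-dec (x Fin.<? b)) ⊎-dec ((b Fin.<? x) ×-dec (x Fin.<? a))

-- The pairs {a,b} and {c,d} are intertwined: the four vertices are distinct
-- and they alternate in the cyclic order (exactly one of c,d lies on each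
-- of the two arcs determined by a and b).
Intertwined : ∀ {n} → Fin n × Fin n → Fin n × Fin n → Set
Intertwined (a , b) (c , d) =
  (a ≢ b × c ≢ d × a ≢ c × a ≢ d × b ≢ c × b ≢ d) ×
  ((Between a b c × ¬ Between a b d) ⊎ (¬ Between a b c × Between a b d))

intertwined? : ∀ {n} (p q : Fin n × Fin n) → Dec (Intertwined p q)
intertwined? (a , b) (c , d) =
  (¬? (a Fin.≟ b) ×-dec ¬? (c Fin.≟ d) ×-dec ¬? (a Fin.≟ c) ×-dec ¬? (a Fin.≟ d)
     ×-dec ¬? (b Fin.≟ c) ×-dec ¬? (b Fin.≟ d))
  ×-dec ((between? a b c ×-dec ¬? (between? a b d))
         ⊎-dec (¬? (between? a b c) ×-dec between? a b d))

IsEdge : ∀ {n} → Graph n → Fin n × Fin n → Set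
IsEdge G (x , y) = x Fin.< y × adj G x y ≡ true

isEdge? : ∀ {n} (G : Graph n) (p : Fin n × Fin n) → Dec (IsEdge G p)
isEdge? G (x , y) = (x Fin.<? y) ×-dec (adj G x y Data.Bool.≟ true)
  where import Data.Bool

edges : ∀ {n} → Graph n → List (Fin n × Fin n)
edges {n} G = filter (isEdge? G) (cartesianProduct (allFin n) (allFin n))

piercing : ∀ {n} → Graph n → Fin n × Fin n → ℕ
piercing G l = length (filter (intertwined? l) (edges G))

Consecutive : ∀ {n} → Fin n → Fin n → Set
Consecutive {n} i j =
  toℕ j ≡ suc (toℕ i) ⊎ toℕ i ≡ suc (toℕ j) ⊎
  (toℕ i ≡ 0 × suc (toℕ j) ≡ n) ⊎ (toℕ j ≡ 0 × suc (toℕ i) ≡ n)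

-- A triangulation of the outer cycle, given by its inner links (the outer
-- links being all pairs of consecutive vertices): n-3 distinct, pairwise
-- non-intertwined pairs of non-consecutive vertices, each written (i , j)
-- with i < j.
record Triangulation (n : ℕ) : Set where
  field
    inner          : List (Fin n × Fin n)
    ordered        : All (λ l → proj₁ l Fin.< proj₂ l) inner
    nonConsecutive : All (λ l → ¬ Consecutive (proj₁ l) (proj₂ l)) inner
    distinct       : AllPairs _≢_ inner
    nonCrossing    : AllPairs (λ l l′ → ¬ Intertwined l l′) inner
    count          : length inner ≡ n ∸ 3
open Triangulation public

IsLink : ∀ {n} → Triangulation n → Fin n × Fin n → Set
IsLink T (i , j) = Consecutive i j ⊎ (i , j) ∈ˡ inner T

EdgePiercingAtMost : ∀ {n} → Graph n → Triangulation n → ℕ → Set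
EdgePiercingAtMost G T c = ∀ l → IsLink T l → piercing G l ≤ c

IsSeparation : ∀ {n} → Graph n → Subset n → Subset n → Set
IsSeparation G A B =
  (∀ x → x ∈ (A ∪ B)) ×
  (∀ x y → x ∈ A → x ∉ B → y ∈ B → y ∉ A → adj G x y ≡ false)

IsBalanced : ∀ {n} → Subset n → Subset n → Set
IsBalanced {n} A B = 3 * ∣ A ─ B ∣ ≤ 2 * n × 3 * ∣ B ─ A ∣ ≤ 2 * n

{-# OPTIONS --safe #-}
module Submission where

-- Read every link {v_a, v_b} (a < b) as the chord (a , b) of the index range 0 … n-1.
-- Pairwise non-crossing chords within [a , b] number at most b - a - 1 (counting
-- (a , b) itself): all the others lie within [a , k] or within [k , b], where k is
-- the last neighbour of a before b.  The inner links together with the outer link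
-- (0 , n-1) attain this bound on [0 , n-1]; attaining it on [a , b] with b > a + 1
-- makes (a , b) a chord and is inherited by [a , k] and [k , b].  So, starting from
-- (0 , n-1) and passing to the longer part while b - a > (2n + 3)/3, we reach a link
-- (i , j) with at most 2n/3 vertices strictly inside and at most 2n/3 strictly outside.
-- An edge from the inside to the outside pierces (i , j); hence i, j and the lower
-- endpoints of the edges piercing (i , j) form a balanced separator of size at most c + 2.

open import Defs hiding (sym)
open import Data.Bool using (true; false)
open import Data.Empty using (⊥; ⊥-elim)
open import Data.Nat using (ℕ; zero; suc; _≤_; _<_; _+_; _∸_; _*_; pred; z≤n; s≤s; s≤s⁻¹; _≟_; _≤?_; _<?_)
open import Data.Nat.Properties
open import Data.Nat.Induction using (<-wellFounded)
open import Data.Nat.Tactic.RingSolver using (solve; solve-∀)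
open import Data.Fin as F using (Fin; toℕ)
import Data.Fin.Properties as F
open import Data.Fin.Subset using (Subset; inside; outside; _∈_; _∉_; _⊆_; _∪_; _∩_; _─_; ∁; ⁅_⁆; ⋃; ∣_∣)
open import Data.Fin.Subset.Properties
  using (_∈?_; x∈p∪q⁺; x∈p∪q⁻; x∈p∩q⁻; x∈⁅x⁆; ∣⁅x⁆∣≡1; ∣⊥∣≡0; p⊆q⇒∣p∣≤∣q∣
        ; x∉p⇒x∈∁p; x∉∁p⇒x∈p; x∈∁p⇒x∉p)
open import Data.List using (List; []; _∷_; [_]; length; filter; map)
open import Data.List.Properties using (length-map; filter-all; filter-none)
open import Data.List.Extrema.Nat using (max; ⊥≤max; max<v⁺; xs≤max; argmax-sel)
open import Data.List.Membership.Propositional using () renaming (_∈_ to _∈ˡ_)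
open import Data.List.Membership.Propositional.Properties
  using (∈-filter⁺; ∈-map⁺; ∈-map⁻; ∈-map∘filter⁻; ∈-cartesianProduct⁺; ∈-allFin)
open import Data.List.Relation.Unary.Any using (Any; here; there; any?)
open import Data.List.Relation.Unary.All as All using (All; []; _∷_)
open import Data.List.Relation.Unary.All.Properties using (¬Any⇒All¬; map⁺; all-filter)
open import Data.List.Relation.Unary.AllPairs as AllPairs using (AllPairs; []; _∷_)
import Data.List.Relation.Unary.AllPairs.Properties as AllPairsₚ
open import Data.Product using (Σ; ∃₂; _×_; _,_; proj₁; proj₂)
open import Data.Product.Properties using (≡-dec)
open import Data.Sum using (_⊎_; inj₁; inj₂; [_,_]′)
open import Data.Vec using ([]; _∷_; here; there)
open import Function.Base using (_∘_)
open import Induction.WellFounded using (Acc; acc)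
open import Level using (0ℓ)
open import Relation.Binary.Definitions using (DecidableEquality; tri<; tri≈; tri>)
open import Relation.Binary.PropositionalEquality.Core using (_≡_; _≢_; refl; sym; trans; cong; cong₂; subst)
open import Relation.Binary.PropositionalEquality.Properties using (module ≡-Reasoning)
open import Relation.Nullary using (¬_; Dec; yes; no)
open import Relation.Nullary.Decidable using (_×-dec_)
open import Relation.Unary using (Pred; Decidable)
open import Relation.Unary.Properties using (_∪?_)

module _ {A : Set} where

  length-filter-⊎ : {P Q R : Pred A 0ℓ} (P? : Decidable P) (Q? : Decidable Q) (R? : Decidable R) →
                    ∀ xs → (∀ {x} → x ∈ˡ xs → P x → Q x ⊎ R x) →
                    length (filter P? xs) ≤ length (filter Q? xs) + length (filter R? xs)
  length-filter-⊎ P? Q? R? [] _ = z≤n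
  length-filter-⊎ P? Q? R? (x ∷ xs) P⊆Q∪R
    with ih ← length-filter-⊎ P? Q? R? xs (λ x∈xs → P⊆Q∪R (there x∈xs)) | P? x | Q? x | R? x
  ... | no _   | no _   | no _    = ih
  ... | no _   | yes _  | no _    = m≤n⇒m≤1+n ih
  ... | no _   | no _   | yes _   = ≤-trans ih (+-monoʳ-≤ _ (n≤1+n _))
  ... | no _   | yes _  | yes _   = ≤-trans ih (+-mono-≤ (n≤1+n _) (n≤1+n _))
  ... | yes _  | yes _  | no _    = s≤s ih
  ... | yes _  | yes _  | yes _   = s≤s (≤-trans ih (+-monoʳ-≤ _ (n≤1+n _)))
  ... | yes _  | no _   | yes _   = ≤-trans (s≤s ih) (≤-reflexive (sym (+-suc _ _)))
  ... | yes px | no ¬qx | no ¬rx  with P⊆Q∪R (here refl) px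
  ...   | inj₁ qx = ⊥-elim (¬qx qx)
  ...   | inj₂ rx = ⊥-elim (¬rx rx)

  length-filter>0⇒Any : {P : Pred A 0ℓ} (P? : Decidable P) → ∀ xs →
                        0 < length (filter P? xs) → Any P xs
  length-filter>0⇒Any P? xs pos with any? P? xs
  ... | yes some = some
  ... | no none rewrite filter-none P? (¬Any⇒All¬ xs none) = ⊥-elim (<-irrefl refl pos)

  length-filter-≡-unique : (_≟_ : DecidableEquality A) → ∀ x {xs} → AllPairs _≢_ xs →
                           length (filter (x ≟_) xs) ≤ 1
  length-filter-≡-unique _≟_ x [] = z≤n
  length-filter-≡-unique _≟_ x {y ∷ xs} (y∉xs ∷ unique) with x ≟ y
  ... | yes refl = s≤s (≤-reflexive (cong length (filter-none (x ≟_) y∉xs)))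
  ... | no _     = length-filter-≡-unique _≟_ x unique

  allPairs-lookup : {R : A → A → Set} {xs : List A} {x y : A} → AllPairs R xs →
                    x ∈ˡ xs → y ∈ˡ xs → x ≡ y ⊎ R x y ⊎ R y x
  allPairs-lookup (_ ∷ _)    (here refl)  (here refl)  = inj₁ refl
  allPairs-lookup (Rx ∷ _)   (here refl)  (there y∈xs) = inj₂ (inj₁ (All.lookup Rx y∈xs))
  allPairs-lookup (Ry ∷ _)   (there x∈xs) (here refl)  = inj₂ (inj₂ (All.lookup Ry x∈xs))
  allPairs-lookup (_ ∷ rest) (there x∈xs) (there y∈xs) = allPairs-lookup rest x∈xs y∈xs

∸-+-∸ : ∀ {a k b} → a ≤ k → k ≤ b → (k ∸ a) + (b ∸ k) ≡ b ∸ a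
∸-+-∸ {a} {k} {b} a≤k k≤b = begin
  (k ∸ a) + (b ∸ k)  ≡⟨ +-comm (k ∸ a) (b ∸ k) ⟩
  (b ∸ k) + (k ∸ a)  ≡⟨ +-∸-assoc (b ∸ k) a≤k ⟨
  (b ∸ k) + k ∸ a    ≡⟨ cong (_∸ a) (m∸n+n≡m k≤b) ⟩
  b ∸ a              ∎
  where open ≡-Reasoning

+-suc-regroup : ∀ a x y → a + suc (1 + (x + y)) ≡ (a + suc x) + suc y
+-suc-regroup = solve-∀

1+n≤3n+3 : ∀ n → suc n ≤ 3 * n + 3
1+n≤3n+3 n = begin
  suc n      ≡⟨ +-comm 1 n ⟩
  n + 1      ≤⟨ +-monoʳ-≤ n (s≤s z≤n) ⟩
  n + 3      ≤⟨ +-monoˡ-≤ 3 (m≤n*m n 3) ⟩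
  3 * n + 3  ∎
  where open ≤-Reasoning

-- A link (i , j) with j - i = d has d - 1 vertices strictly inside and n - d - 1 strictly
-- outside; BalancedSpan n d says that both numbers are at most 2n/3.
BalancedSpan : ℕ → ℕ → Set
BalancedSpan n d = 3 * d ≤ 2 * n + 3 × n ≤ 3 * d + 3

too-long⇒wide : ∀ {n a b} → ¬ 3 * (b ∸ a) ≤ 2 * n + 3 → suc a < b
too-long⇒wide {n} {a} {b} tooLong with suc a <? b
... | yes wide = wide
... | no ¬wide = ⊥-elim (tooLong (begin
  3 * (b ∸ a)  ≤⟨ *-monoʳ-≤ 3 (m≤n+o⇒m∸n≤o b a (≤-trans (≮⇒≥ ¬wide) (≤-reflexive (+-comm 1 a)))) ⟩
  3 * 1        ≤⟨ m≤n+m 3 (2 * n) ⟩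
  2 * n + 3    ∎))
  where open ≤-Reasoning

longer-part-long : ∀ {n x y} → 2 * n + 3 < 3 * (x + y) → y ≤ x → n ≤ 3 * x + 3
longer-part-long {n} {x} {y} tooLong y≤x = *-cancelˡ-≤ 2 (<⇒≤ (begin-strict
  2 * n            ≤⟨ m≤m+n (2 * n) 3 ⟩
  2 * n + 3        <⟨ tooLong ⟩
  3 * (x + y)      ≤⟨ *-monoʳ-≤ 3 (+-monoʳ-≤ x y≤x) ⟩
  3 * (x + x)      ≡⟨ solve [ x ] ⟩
  2 * (3 * x)      ≤⟨ *-monoʳ-≤ 2 (m≤m+n (3 * x) 3) ⟩
  2 * (3 * x + 3)  ∎))
  where open ≤-Reasoning

short-span⇒small-inside : ∀ {n d} → 3 * d ≤ 2 * n + 3 → 3 * pred d ≤ 2 * n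
short-span⇒small-inside {d = zero}  _     = z≤n
short-span⇒small-inside {n} {suc d} short = +-cancelʳ-≤ 3 (3 * d) (2 * n) (begin
  3 * d + 3   ≡⟨ +-comm (3 * d) 3 ⟩
  3 + 3 * d   ≡⟨ *-suc 3 d ⟨
  3 * suc d   ≤⟨ short ⟩
  2 * n + 3   ∎)
  where open ≤-Reasoning

long-span⇒small-outside : ∀ {n s d} → s + suc d ≡ n → n ≤ 3 * d + 3 → 3 * s ≤ 2 * n
long-span⇒small-outside {s = s} {d} refl long = begin
  3 * s                ≡⟨ solve [ s ] ⟩
  2 * s + s            ≤⟨ +-monoʳ-≤ (2 * s) s≤2+2d ⟩
  2 * s + (2 + 2 * d)  ≡⟨ cong (2 * s +_) (*-suc 2 d) ⟨
  2 * s + 2 * suc d    ≡⟨ *-distribˡ-+ 2 s (suc d) ⟨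
  2 * (s + suc d)      ∎
  where
  open ≤-Reasoning
  s≤2+2d : s ≤ 2 + 2 * d
  s≤2+2d = +-cancelʳ-≤ (suc d) s (2 + 2 * d) (≤-trans long (≤-reflexive (solve [ d ])))

outside+span≡n : ∀ {i j n} → i ≤ j → j < n → (i + (n ∸ suc j)) + suc (j ∸ i) ≡ n
outside+span≡n {i} {j} {n} i≤j j<n = begin
  (i + r) + suc d  ≡⟨ +-assoc i r (suc d) ⟩
  i + (r + suc d)  ≡⟨ cong (i +_) (+-comm r (suc d)) ⟩
  i + (suc d + r)  ≡⟨ +-assoc i (suc d) r ⟨
  (i + suc d) + r  ≡⟨ cong (_+ r) (+-suc i d) ⟩
  suc (i + d) + r  ≡⟨ cong (λ t → suc t + r) (m+[n∸m]≡n i≤j) ⟩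
  suc j + r        ≡⟨ m+[n∸m]≡n j<n ⟩
  n                ∎
  where
  open ≡-Reasoning
  r = n ∸ suc j
  d = j ∸ i

-- Non-crossing chords

_≟₂_ : DecidableEquality (ℕ × ℕ)
_≟₂_ = ≡-dec _≟_ _≟_

module NonCrossingChords
  (L : List (ℕ × ℕ))
  (wide : All (λ c → suc (proj₁ c) < proj₂ c) L)
  (distinct : AllPairs _≢_ L)
  (nonCrossing : ∀ {a k i j} → (a , k) ∈ˡ L → (i , j) ∈ˡ L → a < i → i < k → k < j → ⊥)
  where

  Within : ℕ → ℕ → Pred (ℕ × ℕ) 0ℓ
  Within a b (i , j) = a ≤ i × j ≤ b

  within? : ∀ a b → Decidable (Within a b)
  within? a b (i , j) = (a ≤? i) ×-dec (j ≤? b)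

  #within : ℕ → ℕ → ℕ
  #within a b = length (filter (within? a b) L)

  #occurrences : ℕ → ℕ → ℕ
  #occurrences a b = length (filter ((a , b) ≟₂_) L)

  #within-narrow : ∀ {a b} → ¬ suc a < b → #within a b ≡ 0
  #within-narrow {a} {b} narrow = cong length (filter-none (within? a b) (All.map does-not-fit wide))
    where
    does-not-fit : ∀ {c} → suc (proj₁ c) < proj₂ c → ¬ Within a b c
    does-not-fit 1+i<j (a≤i , j≤b) = narrow (≤-trans (s≤s (s≤s a≤i)) (≤-trans 1+i<j j≤b))

  NeighbourBelow : ℕ → ℕ → Pred (ℕ × ℕ) 0ℓ
  NeighbourBelow a b (i , j) = i ≡ a × j < b

  neighbourBelow? : ∀ a b → Decidable (NeighbourBelow a b)
  neighbourBelow? a b (i , j) = (i ≟ a) ×-dec (j <? b)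

  neighboursBelow : ℕ → ℕ → List ℕ
  neighboursBelow a b = map proj₂ (filter (neighbourBelow? a b) L)

  -- The third vertex of the triangle on (a , b) once [a , b] is triangulated.
  apex : ℕ → ℕ → ℕ
  apex a b = max (suc a) (neighboursBelow a b)

  a<apex : ∀ a b → a < apex a b
  a<apex a b = ⊥≤max (suc a) (neighboursBelow a b)

  apex<b : ∀ {a b} → suc a < b → apex a b < b
  apex<b {a} {b} 1+a<b = max<v⁺ 1+a<b (map⁺ (All.map proj₂ (all-filter (neighbourBelow? a b) L)))

  apex-maximal : ∀ {a b j} → (a , j) ∈ˡ L → j < b → j ≤ apex a b
  apex-maximal {a} {b} aj∈L j<b =
    All.lookup (xs≤max (suc a) (neighboursBelow a b))
               (∈-map⁺ proj₂ (∈-filter⁺ (neighbourBelow? a b) aj∈L (refl , j<b)))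

  apex-chord : ∀ a b → apex a b ≡ suc a ⊎ (a , apex a b) ∈ˡ L
  apex-chord a b with argmax-sel (λ x → x) (suc a) (neighboursBelow a b)
  ... | inj₁ default = inj₁ default
  ... | inj₂ apex∈ with ∈-map∘filter⁻ proj₂ (neighbourBelow? a b) apex∈
  ...   | (_ , j) , aj∈L , refl , refl , _ = inj₂ aj∈L

  #within-split : ∀ {a b} → suc a < b →
                  #within a b ≤ #occurrences a b + (#within a (apex a b) + #within (apex a b) b)
  #within-split {a} {b} 1+a<b =
    ≤-trans (length-filter-⊎ (within? a b) ((a , b) ≟₂_) (within? a k ∪? within? k b) L classify)
            (+-monoʳ-≤ (#occurrences a b)
              (length-filter-⊎ (within? a k ∪? within? k b) (within? a k) (within? k b) L (λ _ w → w)))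
    where
    k = apex a b
    classify : ∀ {c} → c ∈ˡ L → Within a b c → (a , b) ≡ c ⊎ (Within a k c ⊎ Within k b c)
    classify {i , j} ij∈L (a≤i , j≤b) with j ≤? k | k ≤? i
    ... | yes j≤k | _       = inj₂ (inj₁ (a≤i , j≤k))
    ... | no _    | yes k≤i = inj₂ (inj₂ (k≤i , j≤b))
    ... | no j≰k  | no k≰i  with m≤n⇒m<n∨m≡n a≤i | m≤n⇒m<n∨m≡n j≤b
    ...   | inj₂ refl | inj₂ refl = inj₁ refl
    ...   | inj₂ refl | inj₁ j<b  = ⊥-elim (j≰k (apex-maximal ij∈L j<b))
    ...   | inj₁ a<i  | _         with apex-chord a b
    ...     | inj₁ k≡1+a = ⊥-elim (k≰i (subst (_≤ i) (sym k≡1+a) a<i))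
    ...     | inj₂ ak∈L  = ⊥-elim (nonCrossing ak∈L ij∈L a<i (≰⇒> k≰i) (≰⇒> j≰k))

  #within≤1+parts : ∀ {a b} → suc a < b →
                    #within a b ≤ suc (#within a (apex a b) + #within (apex a b) b)
  #within≤1+parts {a} {b} 1+a<b =
    ≤-trans (#within-split 1+a<b) (+-monoˡ-≤ _ (length-filter-≡-unique _≟₂_ (a , b) distinct))

  #within-bound : ∀ {a b} → a < b → a + suc (#within a b) ≤ b
  #within-bound = go (<-wellFounded _)
    where
    go : ∀ {a b} → Acc _<_ (b ∸ a) → a < b → a + suc (#within a b) ≤ b
    go {a} {b} (acc rec) a<b with suc a <? b
    ... | no narrow rewrite #within-narrow narrow | +-comm a 1 = a<b
    ... | yes 1+a<b = begin
      a + suc (#within a b)    ≤⟨ +-monoʳ-≤ a (s≤s (#within≤1+parts 1+a<b)) ⟩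
      a + suc (1 + (wL + wR))  ≡⟨ +-suc-regroup a wL wR ⟩
      (a + suc wL) + suc wR    ≤⟨ +-monoˡ-≤ (suc wR) (go (rec (∸-monoˡ-< k<b (<⇒≤ a<k))) a<k) ⟩
      k + suc wR               ≤⟨ go (rec (∸-monoʳ-< a<k (<⇒≤ k<b))) k<b ⟩
      b                        ∎
      where
      open ≤-Reasoning
      k = apex a b
      wL = #within a k
      wR = #within k b
      a<k = a<apex a b
      k<b = apex<b 1+a<b

  -- Equality in #within-bound: the chords within [a , b] triangulate the polygon a … b.
  Saturated : ℕ → ℕ → Set
  Saturated a b = b ≤ a + suc (#within a b)

  saturated-split : ∀ {a b} → suc a < b → Saturated a b →
                    (a , b) ∈ˡ L × Saturated a (apex a b) × Saturated (apex a b) b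
  saturated-split {a} {b} 1+a<b sat = chord , sat-left , sat-right
    where
    open ≤-Reasoning
    k = apex a b
    wL = #within a k
    wR = #within k b
    bound-left : a + suc wL ≤ k
    bound-left = #within-bound (a<apex a b)
    bound-right : k + suc wR ≤ b
    bound-right = #within-bound (apex<b 1+a<b)
    tight : a + suc (1 + (wL + wR)) ≤ a + suc (#occurrences a b + (wL + wR))
    tight = begin
      a + suc (1 + (wL + wR))                 ≡⟨ +-suc-regroup a wL wR ⟩
      (a + suc wL) + suc wR                   ≤⟨ +-monoˡ-≤ (suc wR) bound-left ⟩
      k + suc wR                              ≤⟨ bound-right ⟩
      b                                       ≤⟨ sat ⟩
      a + suc (#within a b)                   ≤⟨ +-monoʳ-≤ a (s≤s (#within-split 1+a<b)) ⟩
      a + suc (#occurrences a b + (wL + wR))  ∎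
    chord : (a , b) ∈ˡ L
    chord = length-filter>0⇒Any ((a , b) ≟₂_) L
              (+-cancelʳ-≤ (wL + wR) 1 (#occurrences a b) (s≤s⁻¹ (+-cancelˡ-≤ a _ _ tight)))
    b≤parts : b ≤ (a + suc wL) + suc wR
    b≤parts = begin
      b                        ≤⟨ sat ⟩
      a + suc (#within a b)    ≤⟨ +-monoʳ-≤ a (s≤s (#within≤1+parts 1+a<b)) ⟩
      a + suc (1 + (wL + wR))  ≡⟨ +-suc-regroup a wL wR ⟩
      (a + suc wL) + suc wR    ∎
    sat-left : Saturated a k
    sat-left = +-cancelʳ-≤ (suc wR) k (a + suc wL) (≤-trans bound-right b≤parts)
    sat-right : Saturated k b
    sat-right = ≤-trans b≤parts (+-monoˡ-≤ (suc wR) bound-left)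

  balanced-subinterval : ∀ n {a b} → a < b → Saturated a b → n ≤ 3 * (b ∸ a) + 3 →
    ∃₂ λ a′ b′ → a′ < b′ × b′ ≤ b × Saturated a′ b′ × BalancedSpan n (b′ ∸ a′)
  balanced-subinterval n {a₀} {b₀} a₀<b₀ = go (<-wellFounded _) a₀<b₀ ≤-refl
    where
    Result : Set
    Result = ∃₂ λ a′ b′ → a′ < b′ × b′ ≤ b₀ × Saturated a′ b′ × BalancedSpan n (b′ ∸ a′)

    go : ∀ {a b} → Acc _<_ (b ∸ a) → a < b → b ≤ b₀ → Saturated a b →
         n ≤ 3 * (b ∸ a) + 3 → Result
    go {a} {b} (acc rec) a<b b≤b₀ sat long with 3 * (b ∸ a) ≤? 2 * n + 3
    ... | yes short  = a , b , a<b , b≤b₀ , sat , short , long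
    ... | no tooLong = descend (b ∸ k ≤? k ∸ a)
      where
      1+a<b = too-long⇒wide {n} tooLong
      k = apex a b
      a<k = a<apex a b
      k<b = apex<b 1+a<b
      tooLong′ : 2 * n + 3 < 3 * ((k ∸ a) + (b ∸ k))
      tooLong′ = subst (λ d → 2 * n + 3 < 3 * d) (sym (∸-+-∸ (<⇒≤ a<k) (<⇒≤ k<b))) (≰⇒> tooLong)
      descend : Dec (b ∸ k ≤ k ∸ a) → Result
      descend (yes right≤left) =
        go (rec (∸-monoˡ-< k<b (<⇒≤ a<k))) a<k (≤-trans (<⇒≤ k<b) b≤b₀)
           (proj₁ (proj₂ (saturated-split 1+a<b sat))) (longer-part-long tooLong′ right≤left)
      descend (no right≰left) =
        go (rec (∸-monoʳ-< a<k (<⇒≤ k<b))) k<b b≤b₀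
           (proj₂ (proj₂ (saturated-split 1+a<b sat)))
           (longer-part-long (subst (λ d → 2 * n + 3 < 3 * d) (+-comm (k ∸ a) (b ∸ k)) tooLong′)
                             (<⇒≤ (≰⇒> right≰left)))

  saturated-link : ∀ {a b} → a < b → Saturated a b → b ≡ suc a ⊎ (a , b) ∈ˡ L
  saturated-link {a} {b} a<b sat with suc a <? b
  ... | yes 1+a<b = inj₂ (proj₁ (saturated-split 1+a<b sat))
  ... | no narrow = inj₁ (≤-antisym (≮⇒≥ narrow) a<b)

∣p∪q∣≤∣p∣+∣q∣ : ∀ {n} (p q : Subset n) → ∣ p ∪ q ∣ ≤ ∣ p ∣ + ∣ q ∣
∣p∪q∣≤∣p∣+∣q∣ []            []            = z≤n
∣p∪q∣≤∣p∣+∣q∣ (inside ∷ p)  (inside ∷ q)  =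
  s≤s (≤-trans (∣p∪q∣≤∣p∣+∣q∣ p q) (+-monoʳ-≤ ∣ p ∣ (n≤1+n _)))
∣p∪q∣≤∣p∣+∣q∣ (inside ∷ p)  (outside ∷ q) = s≤s (∣p∪q∣≤∣p∣+∣q∣ p q)
∣p∪q∣≤∣p∣+∣q∣ (outside ∷ p) (inside ∷ q)  =
  ≤-trans (s≤s (∣p∪q∣≤∣p∣+∣q∣ p q)) (≤-reflexive (sym (+-suc _ _)))
∣p∪q∣≤∣p∣+∣q∣ (outside ∷ p) (outside ∷ q) = ∣p∪q∣≤∣p∣+∣q∣ p q

x∈p─q⇒x∉q : ∀ {n} (p q : Subset n) {x} → x ∈ p ─ q → x ∉ q
x∈p─q⇒x∉q (_ ∷ p) (inside ∷ q) () here
x∈p─q⇒x∉q (_ ∷ p) (_ ∷ q) (there x∈p─q) (there x∈q) = x∈p─q⇒x∉q p q x∈p─q x∈q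

∈ˡ⇒∈⋃⁅⁆ : ∀ {n} {x : Fin n} {xs} → x ∈ˡ xs → x ∈ ⋃ (map ⁅_⁆ xs)
∈ˡ⇒∈⋃⁅⁆ {x = x} (here refl) = x∈p∪q⁺ (inj₁ (x∈⁅x⁆ x))
∈ˡ⇒∈⋃⁅⁆         (there x∈xs) = x∈p∪q⁺ (inj₂ (∈ˡ⇒∈⋃⁅⁆ x∈xs))

∣⋃⁅⁆∣≤length : ∀ {n} (xs : List (Fin n)) → ∣ ⋃ (map ⁅_⁆ xs) ∣ ≤ length xs
∣⋃⁅⁆∣≤length {n} []   = ≤-reflexive (∣⊥∣≡0 n)
∣⋃⁅⁆∣≤length (x ∷ xs) = begin
  ∣ ⁅ x ⁆ ∪ ⋃ (map ⁅_⁆ xs) ∣       ≤⟨ ∣p∪q∣≤∣p∣+∣q∣ ⁅ x ⁆ _ ⟩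
  ∣ ⁅ x ⁆ ∣ + ∣ ⋃ (map ⁅_⁆ xs) ∣   ≡⟨ cong (_+ _) (∣⁅x⁆∣≡1 x) ⟩
  suc ∣ ⋃ (map ⁅_⁆ xs) ∣           ≤⟨ s≤s (∣⋃⁅⁆∣≤length xs) ⟩
  suc (length xs)                  ∎
  where open ≤-Reasoning

interval : ∀ {n} → ℕ → ℕ → Subset n
interval {zero}  _        _        = []
interval {suc n} lo       zero     = outside ∷ interval lo zero
interval {suc n} zero     (suc hi) = inside ∷ interval zero hi
interval {suc n} (suc lo) (suc hi) = outside ∷ interval lo hi

∈-interval⁺ : ∀ {n lo hi} (x : Fin n) → lo ≤ toℕ x → toℕ x < hi → x ∈ interval lo hi
∈-interval⁺ {suc n} {zero}   {suc hi} F.zero    _          _          = here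
∈-interval⁺ {suc n} {zero}   {suc hi} (F.suc x) _          (s≤s x<hi) = there (∈-interval⁺ x z≤n x<hi)
∈-interval⁺ {suc n} {suc lo} {suc hi} (F.suc x) (s≤s lo≤x) (s≤s x<hi) = there (∈-interval⁺ x lo≤x x<hi)

∈-interval⁻ : ∀ {n lo hi} (x : Fin n) → x ∈ interval lo hi → lo ≤ toℕ x × toℕ x < hi
∈-interval⁻ {suc n} {lo}     {zero}   (F.suc x) (there x∈) with () ← proj₂ (∈-interval⁻ x x∈)
∈-interval⁻ {suc n} {zero}   {suc hi} F.zero    here       = z≤n , s≤s z≤n
∈-interval⁻ {suc n} {zero}   {suc hi} (F.suc x) (there x∈) = z≤n , s≤s (proj₂ (∈-interval⁻ x x∈))
∈-interval⁻ {suc n} {suc lo} {suc hi} (F.suc x) (there x∈) =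
  let lo≤x , x<hi = ∈-interval⁻ x x∈ in s≤s lo≤x , s≤s x<hi

∣interval∣≤ : ∀ {n} lo hi → ∣ interval {n} lo hi ∣ ≤ hi ∸ lo
∣interval∣≤ {zero}  _        _        = z≤n
∣interval∣≤ {suc n} lo       zero     = ∣interval∣≤ {n} lo zero
∣interval∣≤ {suc n} zero     (suc hi) = s≤s (∣interval∣≤ {n} zero hi)
∣interval∣≤ {suc n} (suc lo) (suc hi) = ∣interval∣≤ {n} lo hi

-- The separator of a link

between-intertwined : ∀ {n} {i j x y : Fin n} → i F.< x → x F.< j → y F.< i ⊎ j F.< y →
                      Intertwined (i , j) (x , y) × Intertwined (i , j) (y , x)
between-intertwined {i = i} {j} {x} {y} i<x x<j y∉[i,j] =
  ((i≢j , x≢y , i≢x , i≢y , j≢x , j≢y) , inj₁ (x-between , y-not-between)) ,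
  ((i≢j , x≢y ∘ sym , i≢y , i≢x , j≢y , j≢x) , inj₂ (y-not-between , x-between))
  where
  i<j = F.<-trans i<x x<j
  i≢j = F.<⇒≢ i<j
  i≢x = F.<⇒≢ i<x
  j≢x = F.<⇒≢ x<j ∘ sym
  y≢ : ∀ {z} → i F.≤ z → z F.≤ j → y ≢ z
  y≢ i≤z z≤j refl = [ (λ y<i → <⇒≱ y<i i≤z) , (λ j<y → <⇒≱ j<y z≤j) ]′ y∉[i,j]
  x≢y = y≢ (<⇒≤ i<x) (<⇒≤ x<j) ∘ sym
  i≢y = y≢ ≤-refl (<⇒≤ i<j) ∘ sym
  j≢y = y≢ (<⇒≤ i<j) ≤-refl ∘ sym
  x-between : Between i j x
  x-between = inj₁ (i<x , x<j)
  y-not-between : ¬ Between i j y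
  y-not-between (inj₁ (i<y , y<j)) = y≢ (<⇒≤ i<y) (<⇒≤ y<j) refl
  y-not-between (inj₂ (j<y , y<i)) = <-asym i<j (<-trans j<y y<i)

∈-edges : ∀ {n} (G : Graph n) {x y : Fin n} → x F.< y → adj G x y ≡ true → (x , y) ∈ˡ edges G
∈-edges G {x} {y} x<y xy =
  ∈-filter⁺ (isEdge? G) (∈-cartesianProduct⁺ (∈-allFin x) (∈-allFin y)) (x<y , xy)

module LinkSeparation {n} (G : Graph n) (i j : Fin n) (i≤j : i F.≤ j) where

  Inside : Subset n
  Inside = interval (suc (toℕ i)) (toℕ j)

  Outside : Subset n
  Outside = interval 0 (toℕ i) ∪ interval (suc (toℕ j)) n

  piercingEdges : List (Fin n × Fin n)
  piercingEdges = filter (intertwined? (i , j)) (edges G)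

  Pierced : Subset n
  Pierced = ⋃ (map ⁅_⁆ (map proj₁ piercingEdges))

  A B : Subset n
  A = ∁ Outside ∪ Pierced
  B = ∁ Inside ∪ Pierced

  ∈-Outside⁺ : ∀ {x} → x F.< i ⊎ j F.< x → x ∈ Outside
  ∈-Outside⁺ {x} (inj₁ x<i) = x∈p∪q⁺ (inj₁ (∈-interval⁺ x z≤n x<i))
  ∈-Outside⁺ {x} (inj₂ j<x) = x∈p∪q⁺ (inj₂ (∈-interval⁺ x j<x (F.toℕ<n x)))

  ∈-Outside⁻ : ∀ {x} → x ∈ Outside → x F.< i ⊎ j F.< x
  ∈-Outside⁻ {x} x∈ with x∈p∪q⁻ (interval 0 (toℕ i)) _ x∈
  ... | inj₁ x∈left  = inj₁ (proj₂ (∈-interval⁻ x x∈left))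
  ... | inj₂ x∈right = inj₂ (proj₁ (∈-interval⁻ x x∈right))

  x∈Inside⇒x∉Outside : ∀ {x} → x ∈ Inside → x ∉ Outside
  x∈Inside⇒x∉Outside {x} x∈Inside x∈Outside with ∈-interval⁻ x x∈Inside | ∈-Outside⁻ x∈Outside
  ... | i<x , _   | inj₁ x<i = <-asym i<x x<i
  ... | _   , x<j | inj₂ j<x = <-asym x<j j<x

  endpoint : ∀ x → x ∉ Inside → x ∉ Outside → x ≡ i ⊎ x ≡ j
  endpoint x x∉Inside x∉Outside with F.<-cmp x i | F.<-cmp x j
  ... | tri≈ _ x≡i _ | _            = inj₁ x≡i
  ... | _            | tri≈ _ x≡j _ = inj₂ x≡j
  ... | tri< x<i _ _ | _            = ⊥-elim (x∉Outside (∈-Outside⁺ (inj₁ x<i)))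
  ... | _            | tri> _ _ j<x = ⊥-elim (x∉Outside (∈-Outside⁺ (inj₂ j<x)))
  ... | tri> _ _ i<x | tri< x<j _ _ = ⊥-elim (x∉Inside (∈-interval⁺ x i<x x<j))

  ∈-Pierced : ∀ {e} → e ∈ˡ edges G → Intertwined (i , j) e → proj₁ e ∈ Pierced
  ∈-Pierced e∈edges e-pierces =
    ∈ˡ⇒∈⋃⁅⁆ (∈-map⁺ proj₁ (∈-filter⁺ (intertwined? (i , j)) e∈edges e-pierces))

  crossing-edge-pierced : ∀ {x y} → x ∈ Inside → y ∈ Outside → adj G x y ≡ true →
                          x ∈ Pierced ⊎ y ∈ Pierced
  crossing-edge-pierced {x} {y} x∈Inside y∈Outside xy
    with i<x , x<j ← ∈-interval⁻ x x∈Inside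
    with xy-pierces , yx-pierces ← between-intertwined i<x x<j (∈-Outside⁻ y∈Outside)
    with F.<-cmp x y
  ... | tri< x<y _ _  = inj₁ (∈-Pierced (∈-edges G x<y xy) xy-pierces)
  ... | tri≈ _ refl _ = ⊥-elim (x∈Inside⇒x∉Outside x∈Inside y∈Outside)
  ... | tri> _ _ y<x  = inj₂ (∈-Pierced (∈-edges G y<x (trans (Graph.sym G y x) xy)) yx-pierces)

  separation : IsSeparation G A B
  separation = cover , no-crossing-edge
    where
    cover : ∀ x → x ∈ A ∪ B
    cover x with x ∈? Inside
    ... | yes x∈Inside = x∈p∪q⁺ (inj₁ (x∈p∪q⁺ (inj₁ (x∉p⇒x∈∁p (x∈Inside⇒x∉Outside x∈Inside)))))
    ... | no  x∉Inside = x∈p∪q⁺ (inj₂ (x∈p∪q⁺ (inj₁ (x∉p⇒x∈∁p x∉Inside))))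
    no-crossing-edge : ∀ x y → x ∈ A → x ∉ B → y ∈ B → y ∉ A → adj G x y ≡ false
    no-crossing-edge x y _ x∉B _ y∉A with adj G x y in xy
    ... | false = refl
    ... | true with crossing-edge-pierced (x∉∁p⇒x∈p (x∉B ∘ x∈p∪q⁺ ∘ inj₁))
                                          (x∉∁p⇒x∈p (y∉A ∘ x∈p∪q⁺ ∘ inj₁)) xy
    ...   | inj₁ x∈Pierced = ⊥-elim (x∉B (x∈p∪q⁺ (inj₂ x∈Pierced)))
    ...   | inj₂ y∈Pierced = ⊥-elim (y∉A (x∈p∪q⁺ (inj₂ y∈Pierced)))

  A─B⊆Inside : A ─ B ⊆ Inside
  A─B⊆Inside x∈A─B = x∉∁p⇒x∈p (x∈p─q⇒x∉q A B x∈A─B ∘ x∈p∪q⁺ ∘ inj₁)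

  B─A⊆Outside : B ─ A ⊆ Outside
  B─A⊆Outside x∈B─A = x∉∁p⇒x∈p (x∈p─q⇒x∉q B A x∈B─A ∘ x∈p∪q⁺ ∘ inj₁)

  balanced : BalancedSpan n (toℕ j ∸ toℕ i) → IsBalanced A B
  balanced (short , long) = inside-small , outside-small
    where
    open ≤-Reasoning
    inside-small : 3 * ∣ A ─ B ∣ ≤ 2 * n
    inside-small = begin
      3 * ∣ A ─ B ∣              ≤⟨ *-monoʳ-≤ 3 (p⊆q⇒∣p∣≤∣q∣ {p = A ─ B} A─B⊆Inside) ⟩
      3 * ∣ Inside ∣             ≤⟨ *-monoʳ-≤ 3 (∣interval∣≤ {n} (suc (toℕ i)) (toℕ j)) ⟩
      3 * (toℕ j ∸ suc (toℕ i))  ≡⟨ cong (3 *_) (pred[m∸n]≡m∸[1+n] (toℕ j) (toℕ i)) ⟨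
      3 * pred (toℕ j ∸ toℕ i)   ≤⟨ short-span⇒small-inside {n} {toℕ j ∸ toℕ i} short ⟩
      2 * n                      ∎
    outside-small : 3 * ∣ B ─ A ∣ ≤ 2 * n
    outside-small = begin
      3 * ∣ B ─ A ∣                    ≤⟨ *-monoʳ-≤ 3 (p⊆q⇒∣p∣≤∣q∣ {p = B ─ A} B─A⊆Outside) ⟩
      3 * ∣ Outside ∣                  ≤⟨ *-monoʳ-≤ 3 (∣p∪q∣≤∣p∣+∣q∣ left right) ⟩
      3 * (∣ left ∣ + ∣ right ∣)       ≤⟨ *-monoʳ-≤ 3 (+-mono-≤ (∣interval∣≤ {n} 0 (toℕ i))
                                                             (∣interval∣≤ {n} (suc (toℕ j)) n)) ⟩
      3 * (toℕ i + (n ∸ suc (toℕ j)))  ≤⟨ long-span⇒small-outside (outside+span≡n i≤j (F.toℕ<n j)) long ⟩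
      2 * n                            ∎
      where
      left right : Subset n
      left = interval 0 (toℕ i)
      right = interval (suc (toℕ j)) n

  A∩B⊆Pierced∪ends : A ∩ B ⊆ Pierced ∪ (⁅ i ⁆ ∪ ⁅ j ⁆)
  A∩B⊆Pierced∪ends {x} x∈A∩B
    with x∈A , x∈B ← x∈p∩q⁻ A B x∈A∩B
    with x∈p∪q⁻ (∁ Outside) Pierced x∈A | x∈p∪q⁻ (∁ Inside) Pierced x∈B
  ... | inj₂ x∈Pierced | _              = x∈p∪q⁺ (inj₁ x∈Pierced)
  ... | _              | inj₂ x∈Pierced = x∈p∪q⁺ (inj₁ x∈Pierced)
  ... | inj₁ x∈∁Outside | inj₁ x∈∁Inside with endpoint x (x∈∁p⇒x∉p x∈∁Inside) (x∈∁p⇒x∉p x∈∁Outside)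
  ...   | inj₁ refl = x∈p∪q⁺ (inj₂ (x∈p∪q⁺ (inj₁ (x∈⁅x⁆ i))))
  ...   | inj₂ refl = x∈p∪q⁺ (inj₂ (x∈p∪q⁺ (inj₂ (x∈⁅x⁆ j))))

  separator-size : ∣ A ∩ B ∣ ≤ piercing G (i , j) + 2
  separator-size = begin
    ∣ A ∩ B ∣                        ≤⟨ p⊆q⇒∣p∣≤∣q∣ {p = A ∩ B} A∩B⊆Pierced∪ends ⟩
    ∣ Pierced ∪ (⁅ i ⁆ ∪ ⁅ j ⁆) ∣    ≤⟨ ∣p∪q∣≤∣p∣+∣q∣ Pierced (⁅ i ⁆ ∪ ⁅ j ⁆) ⟩
    ∣ Pierced ∣ + ∣ ⁅ i ⁆ ∪ ⁅ j ⁆ ∣  ≤⟨ +-mono-≤ (∣⋃⁅⁆∣≤length (map proj₁ piercingEdges))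
                                                 (∣p∪q∣≤∣p∣+∣q∣ ⁅ i ⁆ ⁅ j ⁆) ⟩
    length (map proj₁ piercingEdges) + (∣ ⁅ i ⁆ ∣ + ∣ ⁅ j ⁆ ∣)
      ≡⟨ cong₂ _+_ (length-map proj₁ piercingEdges) (cong₂ _+_ (∣⁅x⁆∣≡1 i) (∣⁅x⁆∣≡1 j)) ⟩
    piercing G (i , j) + 2           ∎
    where open ≤-Reasoning

-- The chords of a triangulation

toℕ² : ∀ {n} → Fin n × Fin n → ℕ × ℕ
toℕ² (i , j) = toℕ i , toℕ j

toℕ²-injective : ∀ {n} {p q : Fin n × Fin n} → toℕ² p ≡ toℕ² q → p ≡ q
toℕ²-injective {p = _ , _} {_ , _} eq
  with refl ← F.toℕ-injective (cong proj₁ eq) | refl ← F.toℕ-injective (cong proj₂ eq) = refl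

module TriangulationChords {m} (T : Triangulation (3 + m)) where

  last : ℕ
  last = 2 + m

  innerChords : List (ℕ × ℕ)
  innerChords = map toℕ² (inner T)

  -- With the outer link (0 , last) counted as a chord, [0 , last] is saturated.
  chords : List (ℕ × ℕ)
  chords = (0 , last) ∷ innerChords

  chords-wide : All (λ c → suc (proj₁ c) < proj₂ c) chords
  chords-wide = s≤s (s≤s z≤n) ∷ map⁺ (All.zipWith wide (ordered T , nonConsecutive T))
    where
    wide : ∀ {l} → proj₁ l F.< proj₂ l × ¬ Consecutive (proj₁ l) (proj₂ l) →
           suc (toℕ (proj₁ l)) < toℕ (proj₂ l)
    wide (i<j , nonConsec) = ≤∧≢⇒< i<j (nonConsec ∘ inj₁ ∘ sym)

  innerChords-below-last : All (λ c → proj₂ c ≤ last) innerChords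
  innerChords-below-last = map⁺ (All.tabulate λ {l} _ → s≤s⁻¹ (F.toℕ<n (proj₂ l)))

  chords-distinct : AllPairs _≢_ chords
  chords-distinct = map⁺ (All.map outer-not-inner (nonConsecutive T))
                  ∷ AllPairsₚ.map⁺ (AllPairs.map (λ l≢l′ → l≢l′ ∘ toℕ²-injective) (distinct T))
    where
    outer-not-inner : ∀ {l} → ¬ Consecutive (proj₁ l) (proj₂ l) → (0 , last) ≢ toℕ² l
    outer-not-inner nonConsec eq =
      nonConsec (inj₂ (inj₂ (inj₁ (sym (cong proj₁ eq) , cong suc (sym (cong proj₂ eq))))))

  chords-nonCrossing : ∀ {a k i j} → (a , k) ∈ˡ chords → (i , j) ∈ˡ chords →
                       a < i → i < k → k < j → ⊥
  chords-nonCrossing (here refl) (here refl) _ _ last<last = <-irrefl refl last<last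
  chords-nonCrossing (here refl) (there ij∈) _ _ last<j    =
    <⇒≱ last<j (All.lookup innerChords-below-last ij∈)
  chords-nonCrossing (there _)   (here refl) () _ _
  chords-nonCrossing (there ak∈) (there ij∈) a<i i<k k<j
    with (_ , _) , ak∈T , refl ← ∈-map⁻ toℕ² ak∈ | (_ , _) , ij∈T , refl ← ∈-map⁻ toℕ² ij∈
    with allPairs-lookup (nonCrossing T) ak∈T ij∈T
  ... | inj₁ refl          = <-irrefl refl a<i
  ... | inj₂ (inj₁ ¬ak⋈ij) = ¬ak⋈ij (proj₁ (between-intertwined a<i i<k (inj₂ k<j)))
  ... | inj₂ (inj₂ ¬ij⋈ak) = ¬ij⋈ak (proj₂ (between-intertwined i<k k<j (inj₁ a<i)))

  open NonCrossingChords chords chords-wide chords-distinct chords-nonCrossing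

  chords-saturated : Saturated 0 last
  chords-saturated = ≤-reflexive (cong suc (sym (begin
    length (filter (within? 0 last) chords)  ≡⟨ cong length (filter-all (within? 0 last) within-last) ⟩
    suc (length innerChords)                ≡⟨ cong suc (length-map toℕ² (inner T)) ⟩
    suc (length (inner T))                  ≡⟨ cong suc (count T) ⟩
    suc m                                   ∎)))
    where
    open ≡-Reasoning
    within-last : All (Within 0 last) chords
    within-last = (z≤n , ≤-refl) ∷ All.map (z≤n ,_) innerChords-below-last

  chord-link : ∀ {a b} → a < b → b ≤ last → b ≡ suc a ⊎ (a , b) ∈ˡ chords →
               ∃₂ λ i j → toℕ i ≡ a × toℕ j ≡ b × IsLink T (i , j)
  chord-link a<b b≤last (inj₁ refl) =
    F.fromℕ< a<n , F.fromℕ< b<n , F.toℕ-fromℕ< a<n , F.toℕ-fromℕ< b<n ,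
    inj₁ (inj₁ (trans (F.toℕ-fromℕ< b<n) (cong suc (sym (F.toℕ-fromℕ< a<n)))))
    where
    b<n = s≤s b≤last
    a<n = <-trans a<b b<n
  chord-link _ _ (inj₂ (here refl)) =
    F.zero , F.fromℕ last , refl , F.toℕ-fromℕ last ,
    inj₁ (inj₂ (inj₂ (inj₁ (refl , cong suc (F.toℕ-fromℕ last)))))
  chord-link _ _ (inj₂ (there ab∈))
    with (i , j) , ij∈T , refl ← ∈-map⁻ toℕ² ab∈ = i , j , refl , refl , inj₂ ij∈T

  balancedChordLink : ∃₂ λ i j → i F.≤ j × IsLink T (i , j) × BalancedSpan (3 + m) (toℕ j ∸ toℕ i)
  balancedChordLink
    with a , b , a<b , b≤last , sat , balanced
           ← balanced-subinterval (3 + m) (s≤s z≤n) chords-saturated (1+n≤3n+3 last)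
    with i , j , refl , refl , link ← chord-link a<b b≤last (saturated-link a<b sat)
    = i , j , <⇒≤ a<b , link , balanced

balancedLink : ∀ {m} (T : Triangulation (suc m)) →
               ∃₂ λ i j → i F.≤ j × IsLink T (i , j) × BalancedSpan (suc m) (toℕ j ∸ toℕ i)
balancedLink {zero}        T = F.zero , F.zero , z≤n , inj₁ (inj₂ (inj₂ (inj₁ (refl , refl)))) , z≤n , s≤s z≤n
balancedLink {suc zero}    T = F.zero , F.suc F.zero , z≤n , inj₁ (inj₁ refl) , m≤m+n 3 4 , m≤m+n 2 4
balancedLink {suc (suc m)} T = TriangulationChords.balancedChordLink T

lemma15 : (n c : ℕ) (G : Graph n) (T : Triangulation n) →
    EdgePiercingAtMost G T c →
    Σ (Subset n) (λ A → Σ (Subset n) (λ B →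
      IsSeparation G A B × IsBalanced A B × ∣ A ∩ B ∣ ≤ c + 2))
lemma15 zero    c G T _ = [] , [] , ((λ ()) , (λ ())) , (z≤n , z≤n) , z≤n
lemma15 (suc m) c G T piercing≤c
  with i , j , i≤j , link , balancedSpan ← balancedLink T =
  A , B , separation , balanced balancedSpan , ≤-trans separator-size (+-monoˡ-≤ 2 (piercing≤c (i , j) link))
  where open LinkSeparation G i j i≤j
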